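{- If a finite simple graph $G$ is positive, then $G$ has an even number of edges.
   Context: A simple graph $G$ is positive if $\hom(G,H)=\sum_{\varphi:V(G)\to V(H)}\prod_{uv\in E(G)}\beta_{\varphi(u)\varphi(v)}\ge0$ for every graph $H$ with real (possibly negative) symmetric edge weights $\beta$, loops allowed; equivalently $t(G,W)=\int_{[0,1]^{V(G)}}\prod_{uv\in E(G)}W(p(u),p(v))\,dp\ge0$ for every bounded symmetric measurable $W:[0,1]^2\to\mathbb R$. -}

module Defs where

open import Data.Nat using (ℕ; zero; suc)
open import Data.Bool using (Bool; true; false; _∧_; if_then_else_)
open import Data.Fin using (Fin; toℕ)
open import Data.Fin.Base using (zero; suc)
open import Data.List using (List; []; _∷_; [_]; map; concatMap; length; foldr; allFin)
open import Data.Product using (_×_; _,_)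
open import Data.Rational using (ℚ; 0ℚ; 1ℚ; _+_; _*_; _≤_)
open import Relation.Binary.PropositionalEquality using (_≡_)
import Data.Nat as N

record SimpleGraph (n : ℕ) : Set where
  field
    adj    : Fin n → Fin n → Bool
    sym    : ∀ i j → adj i j ≡ adj j i
    irrefl : ∀ i → adj i i ≡ false

open SimpleGraph public

edgeList : ∀ {n} → SimpleGraph n → List (Fin n × Fin n)
edgeList {n} G =
  concatMap (λ i → concatMap (λ j →
      if adj G i j ∧ (toℕ i N.<ᵇ toℕ j) then [ (i , j) ] else [])
    (allFin n)) (allFin n)

numEdges : ∀ {n} → SimpleGraph n → ℕ
numEdges G = length (edgeList G)

consMap : ∀ {n m} → Fin m → (Fin n → Fin m) → Fin (suc n) → Fin m
consMap x f zero    = x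
consMap x f (suc i) = f i

allMaps : ∀ n m → List (Fin n → Fin m)
allMaps zero    m = [ (λ ()) ]
allMaps (suc n) m = concatMap (λ x → map (consMap x) (allMaps n m)) (allFin m)

sumℚ : List ℚ → ℚ
sumℚ = foldr _+_ 0ℚ

prodℚ : List ℚ → ℚ
prodℚ = foldr _*_ 1ℚ

-- hom(G,H) for H on vertex set Fin m with edge weights β (loops allowed).
hom : ∀ {n} → SimpleGraph n → (m : ℕ) → (Fin m → Fin m → ℚ) → ℚ
hom {n} G m β =
  sumℚ (map (λ φ → prodℚ (map (λ e → β (φ (Data.Product.proj₁ e)) (φ (Data.Product.proj₂ e))) (edgeList G)))
            (allMaps n m))

Positive : ∀ {n} → SimpleGraph n → Set
Positive G = ∀ (m : ℕ) (β : Fin m → Fin m → ℚ) → (∀ i j → β i j ≡ β j i) → 0ℚ ≤ hom G m β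

module Submission where

-- Test positivity against the smallest possible target: the one-vertex
-- graph H whose loop carries the weight -1.  Every vertex map G → H is
-- constant, there is exactly one of them, and it contributes the product
-- of the weight over all edges of G.  Hence
--
--     hom(G, H) = (-1) ^ e(G),
--
-- and positivity forces (-1) ^ e(G) ≥ 0, which happens only for even e(G).

open import Defs
open import Data.Nat using (ℕ; zero; suc)
open import Data.Nat.Divisibility using (_∣_; divides; ∣m∣n⇒∣m+n; ∣-refl)
open import Data.List using (List; []; _∷_; map; length; _++_)
open import Data.List.Properties using (length-++; length-map)
open import Data.Fin using (Fin)
open import Data.Sum using (_⊎_; inj₁; inj₂)
open import Data.Empty using (⊥; ⊥-elim)
open import Data.Rational using (ℚ; 0ℚ; 1ℚ; -_; _+_; _*_; _≤_; *≤*; +-*-rawSemiring)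
open import Data.Rational.Properties using (+-identityʳ; *-assoc; *-identityˡ)
open import Algebra.Definitions.RawSemiring +-*-rawSemiring using (_×_; _^_)
import Data.Nat as ℕ
import Data.Nat.Properties as ℕ
open import Relation.Binary.PropositionalEquality using (_≡_; refl; trans; cong; subst; module ≡-Reasoning)
open ≡-Reasoning

sumℚ-const : ∀ {A : Set} (c : ℚ) (xs : List A) → sumℚ (map (λ _ → c) xs) ≡ length xs × c
sumℚ-const c []       = refl
sumℚ-const c (x ∷ xs) = cong (c +_) (sumℚ-const c xs)

prodℚ-const : ∀ {A : Set} (c : ℚ) (xs : List A) → prodℚ (map (λ _ → c) xs) ≡ c ^ length xs
prodℚ-const c []       = refl
prodℚ-const c (x ∷ xs) = cong (c *_) (prodℚ-const c xs)

allMaps-into-one : ∀ n → length (allMaps n 1) ≡ 1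
allMaps-into-one zero    = refl
allMaps-into-one (suc n) = begin
  length (map (consMap Fin.zero) (allMaps n 1) ++ [])
    ≡⟨ length-++ (map (consMap Fin.zero) (allMaps n 1)) ⟩
  length (map (consMap Fin.zero) (allMaps n 1)) ℕ.+ 0
    ≡⟨ ℕ.+-identityʳ _ ⟩
  length (map (consMap Fin.zero) (allMaps n 1))
    ≡⟨ length-map (consMap Fin.zero) (allMaps n 1) ⟩
  length (allMaps n 1)
    ≡⟨ allMaps-into-one n ⟩
  1 ∎

-- hom(G, H) for the one-vertex graph H with loop weight c is c ^ e(G):
-- the unique map sends every edge of G onto the loop.
hom-one-vertex : ∀ {n} (G : SimpleGraph n) (c : ℚ) → hom G 1 (λ _ _ → c) ≡ c ^ numEdges G
hom-one-vertex {n} G c = begin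
  hom G 1 (λ _ _ → c)
    ≡⟨ cong (λ p → sumℚ (map (λ _ → p) (allMaps n 1))) (prodℚ-const c (edgeList G)) ⟩
  sumℚ (map (λ _ → c ^ numEdges G) (allMaps n 1))
    ≡⟨ sumℚ-const (c ^ numEdges G) (allMaps n 1) ⟩
  length (allMaps n 1) × (c ^ numEdges G)
    ≡⟨ cong (_× (c ^ numEdges G)) (allMaps-into-one n) ⟩
  c ^ numEdges G + 0ℚ
    ≡⟨ +-identityʳ (c ^ numEdges G) ⟩
  c ^ numEdges G ∎

negOne-pow-period : ∀ k → (- 1ℚ) ^ suc (suc k) ≡ (- 1ℚ) ^ k
negOne-pow-period k = begin
  - 1ℚ * (- 1ℚ * (- 1ℚ) ^ k)  ≡⟨ *-assoc (- 1ℚ) (- 1ℚ) ((- 1ℚ) ^ k) ⟨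
  1ℚ * (- 1ℚ) ^ k             ≡⟨ *-identityˡ ((- 1ℚ) ^ k) ⟩
  (- 1ℚ) ^ k                  ∎

even-or-negOne : ∀ k → 2 ∣ k ⊎ (- 1ℚ) ^ k ≡ - 1ℚ
even-or-negOne zero          = inj₁ (divides 0 refl)
even-or-negOne (suc zero)    = inj₂ refl
even-or-negOne (suc (suc k)) with even-or-negOne k
... | inj₁ 2∣k   = inj₁ (∣m∣n⇒∣m+n ∣-refl 2∣k)
... | inj₂ k-odd = inj₂ (trans (negOne-pow-period k) k-odd)

nonneg-negOne-pow⇒even : ∀ k → 0ℚ ≤ (- 1ℚ) ^ k → 2 ∣ k
nonneg-negOne-pow⇒even k 0≤pow with even-or-negOne k
... | inj₁ 2∣k   = 2∣k
... | inj₂ k-odd = ⊥-elim (0≰-1 (subst (0ℚ ≤_) k-odd 0≤pow))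
  where
  -- Unfolding ≤ on ℚ, 0 ≤ -1 would require 0 ≤ -1 in ℤ, which has no proof.
  0≰-1 : 0ℚ ≤ - 1ℚ → ⊥
  0≰-1 (*≤* ())

mainTheorem6 : ∀ (n : ℕ) (G : SimpleGraph n) → Positive G → 2 ∣ numEdges G
mainTheorem6 n G positive = nonneg-negOne-pow⇒even (numEdges G) hom-nonneg
  where
  hom-nonneg : 0ℚ ≤ (- 1ℚ) ^ numEdges G
  hom-nonneg = subst (0ℚ ≤_) (hom-one-vertex G (- 1ℚ)) (positive 1 (λ _ _ → - 1ℚ) (λ _ _ → refl))
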